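{- For every integer $n\ge1$, $b(C_{n,n})=n$.
   Context: The burning number of a graph $G$ is $b(G)=\min\{k : \exists v_1,\dots,v_k\in V(G) \text{ with } V(G)=\bigcup_{i=1}^k B(v_i,k-i)\}$, where $B(v,r)$ is the set of vertices at graph distance at most $r$ from $v$. The comb graph $C_{n,m}$ has vertex set $\{(i,j): 1\le i\le m,\ 1\le j\le n\}$ with edges $(1,j)\sim(1,j+1)$ for $1\le j<n$ (the spine) and $(i,j)\sim(i+1,j)$ for $1\le i<m$ (tooth $j$); i.e. a path on $n$ vertices with a path of $m$ vertices (including the spine vertex) hanging from each spine vertex. -}

module Defs where

open import Data.Nat using (ℕ; zero; suc; _∸_; _<_)
open import Data.Fin using (Fin; toℕ)
open import Data.Product using (Σ; _×_; _,_; ∃)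
open import Data.Sum using (_⊎_)
open import Relation.Binary.PropositionalEquality using (_≡_)
open import Relation.Nullary using (¬_)

record Graph : Set₁ where
  field
    V   : Set
    Adj : V → V → Set
open Graph public

data Within (G : Graph) : ℕ → V G → V G → Set where
  here : ∀ {r v} → Within G r v v
  step : ∀ {r u w v} → Adj G u w → Within G r w v → Within G (suc r) u v

-- vs : Fin k → V is a burning sequence of length k: with 0-based index i
-- (paper's index i+1), vertex vs i has radius k - (i+1), and the balls cover V.
IsBurningSeq : (G : Graph) (k : ℕ) → (Fin k → V G) → Set
IsBurningSeq G k vs = ∀ x → ∃ λ (i : Fin k) → Within G (k ∸ suc (toℕ i)) (vs i) x

Burnable : Graph → ℕ → Set
Burnable G k = ∃ λ (vs : Fin k → V G) → IsBurningSeq G k vs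

BurningNumber : Graph → ℕ → Set
BurningNumber G b = Burnable G b × (∀ k → k < b → ¬ Burnable G k)

-- Comb graph C_{n,m}: vertex (i , j) with i : Fin m the (0-based) depth on
-- tooth j : Fin n; depth 0 is the spine vertex. Paper's (i,j) is (i-1 , j-1).
CombAdj : (n m : ℕ) → (Fin m × Fin n) → (Fin m × Fin n) → Set
CombAdj n m (i , j) (i' , j') =
  (toℕ i ≡ 0 × toℕ i' ≡ 0 × (toℕ j' ≡ suc (toℕ j) ⊎ toℕ j ≡ suc (toℕ j')))
  ⊎
  (j ≡ j' × (toℕ i' ≡ suc (toℕ i) ⊎ toℕ i ≡ suc (toℕ i')))

Comb : (n m : ℕ) → Graph
Comb n m = record { V = Fin m × Fin n ; Adj = CombAdj n m }

module Submission where

-- A ball that reaches a tooth j from a vertex on another tooth must pass through the spine, so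
-- its radius exceeds the depth of its centre plus the depth reached on tooth j.  With fewer than
-- n sources some tooth carries none, and the bottom of that tooth (depth n − 1) is then out of
-- reach of every ball, all of whose radii are at most n − 2.  Conversely n sources suffice: the
-- first, at the root of tooth 0 with radius n − 1, covers every vertex whose depth plus tooth
-- index is at most n − 1, and for i ≥ 1 the source at depth i of tooth n − i covers the rest
-- of that tooth.

open import Defs
open import Data.Nat using (ℕ; zero; suc; _+_; _∸_; _≤_; _<_; _≤?_; z≤n; s≤s)
open import Data.Nat.Properties
open import Data.Fin using (Fin; zero; suc; toℕ; fromℕ; fromℕ<; opposite)
open import Data.Fin.Properties
  using (toℕ-fromℕ; toℕ-fromℕ<; toℕ-injective; toℕ<n; ¬∀⟶∃¬; any?; injective⇒≤; opposite-prop; opposite-involutive)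
  renaming (_≟_ to _≟ᶠ_)
open import Data.Product using (∃; _×_; _,_; proj₁; proj₂; map₂)
open import Data.Sum using (inj₁; inj₂)
open import Function using (_∘_)
open import Relation.Binary.PropositionalEquality
open import Relation.Nullary using (¬_; yes; no; contradiction)

Within-weaken : ∀ {G r s u v} → r ≤ s → Within G r u v → Within G s u v
Within-weaken _         here       = here
Within-weaken (s≤s r≤s) (step a p) = step a (Within-weaken r≤s p)

Within-trans : ∀ {G r s u w v} → Within G r u w → Within G s w v → Within G (r + s) u v
Within-trans here       q = Within-weaken (m≤n+m _ _) q
Within-trans (step a p) q = step a (Within-trans p q)

Within-lipschitz : ∀ {G} (f : V G → ℕ) → (∀ {u w} → Adj G u w → f w ≤ suc (f u)) →
                   ∀ {r u v} → Within G r u v → f v ≤ f u + r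
Within-lipschitz f f-step {r} {u} here = m≤m+n (f u) r
Within-lipschitz f f-step {suc r} {u} {v} (step {w = w} a p) = begin
  f v           ≤⟨ Within-lipschitz f f-step p ⟩
  f w + r       ≤⟨ +-monoˡ-≤ r (f-step a) ⟩
  suc (f u) + r ≡⟨ +-suc (f u) r ⟨
  f u + suc r   ∎
  where open ≤-Reasoning

Within-along : ∀ {G n} (p : Fin n → V G) → (∀ {x y} → toℕ y ≡ suc (toℕ x) → Adj G (p x) (p y)) →
               ∀ k {a b} → toℕ b ≡ k + toℕ a → Within G k (p a) (p b)
Within-along p adj zero    b≡a = subst (λ b → Within _ 0 (p _) (p b)) (toℕ-injective (sym b≡a)) here
Within-along {n = n} p adj (suc k) {a} {b} b≡k+1+a =
  step (adj (toℕ-fromℕ< a+1<n)) (Within-along p adj k b≡k+a+1)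
  where
  a+1<n : suc (toℕ a) < n
  a+1<n = ≤-<-trans (subst (suc (toℕ a) ≤_) (sym b≡k+1+a) (s≤s (m≤n+m (toℕ a) k))) (toℕ<n b)
  b≡k+a+1 : toℕ b ≡ k + toℕ (fromℕ< a+1<n)
  b≡k+a+1 = trans b≡k+1+a (trans (sym (+-suc k (toℕ a))) (cong (k +_) (sym (toℕ-fromℕ< a+1<n))))

<⇒notSurjective : ∀ {k n} → k < n → (f : Fin k → Fin n) → ∃ λ j → ∀ i → f i ≢ j
<⇒notSurjective {k} {n} k<n f =
  map₂ (λ unhit i fi≡j → unhit (i , fi≡j))
       (¬∀⟶∃¬ n (λ j → ∃ λ i → f i ≡ j) (λ j → any? (λ i → f i ≟ᶠ j)) ¬surjective)
  where
  ¬surjective : ¬ (∀ j → ∃ λ i → f i ≡ j)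
  ¬surjective hit = <⇒≱ k<n (injective⇒≤ {f = proj₁ ∘ hit}
    (λ {j} {j′} eq → trans (sym (proj₂ (hit j))) (trans (cong f eq) (proj₂ (hit j′)))))

module _ {n m : ℕ} where

  depth : Fin m × Fin n → ℕ
  depth = toℕ ∘ proj₁

  tooth : Fin m × Fin n → Fin n
  tooth = proj₂

  CombAdj-sym : ∀ {u w} → CombAdj n m u w → CombAdj n m w u
  CombAdj-sym (inj₁ (du , dw , inj₁ e)) = inj₁ (dw , du , inj₂ e)
  CombAdj-sym (inj₁ (du , dw , inj₂ e)) = inj₁ (dw , du , inj₁ e)
  CombAdj-sym (inj₂ (refl , inj₁ e))    = inj₂ (refl , inj₂ e)
  CombAdj-sym (inj₂ (refl , inj₂ e))    = inj₂ (refl , inj₁ e)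

  depth-step : ∀ {u w} → CombAdj n m u w → depth w ≤ suc (depth u)
  depth-step (inj₁ (_ , dw , _))     = ≤-trans (≤-reflexive dw) z≤n
  depth-step (inj₂ (_ , inj₁ e))     = ≤-reflexive e
  depth-step (inj₂ (_ , inj₂ e))     = m≤n⇒m≤1+n (≤-trans (n≤1+n _) (≤-reflexive (sym e)))

  tooth-change⇒spine : ∀ {u w} → CombAdj n m u w → tooth u ≢ tooth w → depth u ≡ 0 × depth w ≡ 0
  tooth-change⇒spine (inj₁ (du , dw , _)) _  = du , dw
  tooth-change⇒spine (inj₂ (e , _))       ne = contradiction e ne

  Within-depth : ∀ {r u v} → Within (Comb n m) r u v → depth v ≤ depth u + r
  Within-depth = Within-lipschitz depth depth-step

  Within-across-teeth : ∀ {r u v} → Within (Comb n m) r u v → tooth u ≢ tooth v → depth u + depth v < r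
  Within-across-teeth here ne = contradiction refl ne
  Within-across-teeth {suc r} {u} {v} (step {w = w} a p) ne with tooth w ≟ᶠ tooth v
  ... | yes w≡v with tooth-change⇒spine a (ne ∘ (λ u≡w → trans u≡w w≡v))
  ...   | du , dw =
    s≤s (subst (λ x → x + depth v ≤ r) (sym du) (subst (λ x → depth v ≤ x + r) dw (Within-depth p)))
  Within-across-teeth {suc r} {u} {v} (step {w = w} a p) ne | no w≢v =
    s≤s (≤-trans (+-monoˡ-≤ (depth v) (depth-step (CombAdj-sym a))) (Within-across-teeth p w≢v))

  Within-tooth : ∀ {a d : Fin m} (j : Fin n) → toℕ a ≤ toℕ d → Within (Comb n m) (toℕ d ∸ toℕ a) (a , j) (d , j)
  Within-tooth j a≤d = Within-along (_, j) (λ e → inj₂ (refl , inj₁ e)) _ (sym (m∸n+n≡m a≤d))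

Within-spine : ∀ {n m} {a b : Fin n} → toℕ a ≤ toℕ b → Within (Comb n (suc m)) (toℕ b ∸ toℕ a) (zero , a) (zero , b)
Within-spine a≤b = Within-along (zero ,_) (λ e → inj₁ (refl , refl , inj₁ e)) _ (sym (m∸n+n≡m a≤b))

comb-unburnable : ∀ {n m k} → k < n → k ≤ suc m → ¬ Burnable (Comb n (suc m)) k
comb-unburnable {n} {m} {k} k<n k≤1+m (vs , burns) with <⇒notSurjective k<n (tooth ∘ vs)
... | j , unhit with burns (fromℕ m , j)
...   | i , reach = <⇒≱ m<radius radius≤m
  where
  m<radius : m < k ∸ suc (toℕ i)
  m<radius = ≤-trans (s≤s (subst (_≤ depth (vs i) + toℕ (fromℕ m)) (toℕ-fromℕ m) (m≤n+m _ _)))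
                     (Within-across-teeth reach (unhit i))
  radius≤m : k ∸ suc (toℕ i) ≤ m
  radius≤m = ≤-trans (∸-monoʳ-≤ k (s≤s z≤n)) (∸-monoˡ-≤ 1 k≤1+m)

comb-sources : ∀ {m} → Fin (suc m) → Fin (suc m) × Fin (suc m)
comb-sources zero    = zero , zero
comb-sources (suc i) = suc i , suc (opposite i)   -- tooth m − toℕ i = n − (1 + toℕ i)

Within-root : ∀ {n m r} {d : Fin (suc m)} {j : Fin (suc n)} → toℕ j + toℕ d ≤ r →
              Within (Comb (suc n) (suc m)) r (zero , zero) (d , j)
Within-root {j = j} j+d≤r = Within-weaken j+d≤r (Within-trans (Within-spine z≤n) (Within-tooth j z≤n))

comb-sources-burn : ∀ m → IsBurningSeq (Comb (suc m) (suc m)) (suc m) comb-sources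
comb-sources-burn m (d , j) with toℕ j + toℕ d ≤? m
comb-sources-burn m (d , j)     | yes j+d≤m = zero , Within-root j+d≤m
comb-sources-burn m (d , zero)  | no d≰m    = contradiction (≤-pred (toℕ<n d)) d≰m
comb-sources-burn m (d , suc j) | no j+d≰m  =
  suc (opposite j) ,
  subst (λ t → Within (Comb (suc m) (suc m)) (m ∸ top) (suc (opposite j) , suc t) (d , suc j))
        (sym (opposite-involutive j))
        (Within-weaken (∸-monoˡ-≤ top (≤-pred (toℕ<n d))) (Within-tooth (suc j) top≤d))
  where
  top : ℕ
  top = toℕ (suc (opposite j))
  top≡m-j : top ≡ m ∸ toℕ j
  top≡m-j = trans (cong suc (opposite-prop j)) (sym (+-∸-assoc 1 (toℕ<n j)))
  m≤j+d : m ≤ toℕ j + toℕ d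
  m≤j+d = ≤-pred (≰⇒> j+d≰m)
  top≤d : top ≤ toℕ d
  top≤d = subst (_≤ toℕ d) (sym top≡m-j) (m≤n+o⇒m∸n≤o m (toℕ j) m≤j+d)

lemma3p2 : (n : ℕ) → 1 ≤ n → BurningNumber (Comb n n) n
lemma3p2 (suc m) _ = (comb-sources , comb-sources-burn m) , λ k k<n → comb-unburnable k<n (<⇒≤ k<n)
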